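{- Let $G$ be a connected ribbon graph. Then the highest degree of ${^\partial\varepsilon^{\times}_{G}(z)}$ is $e(G)-v(G)+1$.
   Context: A ribbon graph $G$ is a surface with boundary formed from vertex discs and edge discs (ribbons), each edge attached to vertex discs along two disjoint arcs; $v(G),e(G),f(G),c(G)$ denote the numbers of vertices, edges, boundary components and connected components, and the Euler genus is $\varepsilon(G)=2c(G)-v(G)+e(G)-f(G)$. For $A\subseteq E(G)$, the partial Petrial $G^{\times|A}$ is obtained from $G$ by adding a half-twist to each edge in $A$, and the partial Petrial polynomial is ${^\partial\varepsilon^{\times}_{G}(z)}=\sum_{A\subseteq E(G)} z^{\varepsilon(G^{\times|A})}$. -}

module Defs where

open import Function using (_∘_)
open import Data.Nat as ℕ using (ℕ; zero; suc; _*_)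
open import Data.Fin as Fin using (Fin; toℕ; combine; remQuot)
open import Data.Fin.Permutation using (Permutation′; _⟨$⟩ʳ_; _⟨$⟩ˡ_)
open import Data.Bool using (Bool; true; false; _∧_; _∨_; not; _xor_; if_then_else_)
open import Data.Vec using (Vec; []; _∷_; lookup)
open import Data.List as List using (List; []; _∷_; map; _++_; filter; length)
open import Data.Bool.ListAction using () renaming (any to anyL)
open import Data.Product using (_×_; _,_; proj₁; proj₂)
open import Data.Integer as ℤ using (ℤ; +_)
open import Relation.Nullary.Decidable using (⌊_⌋)
open import Relation.Nullary using (¬_)
open import Relation.Binary.PropositionalEquality using (_≡_; _≢_)

anyFin : ∀ {n} → (Fin n → Bool) → Bool
anyFin {zero}  p = false
anyFin {suc n} p = p Fin.zero ∨ anyFin (λ i → p (Fin.suc i))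

countFin : ∀ {n} → (Fin n → Bool) → ℕ
countFin {zero}  p = 0
countFin {suc n} p = (if p Fin.zero then 1 else 0) ℕ.+ countFin (p ∘ Fin.suc)

_==_ : ∀ {n} → Fin n → Fin n → Bool
x == y = ⌊ x Fin.≟ y ⌋

reach : ∀ {n} → List (Fin n → Fin n) → ℕ → Fin n → Fin n → Bool
reach gs zero    x y = x == y
reach gs (suc k) x y =
  reach gs k x y ∨ anyFin (λ z → reach gs k x z ∧ anyL (λ g → g z == y) gs)

-- Number of orbits of the group generated by a list of permutations of Fin n
-- (for permutations, forward reachability is the orbit relation); counted as
-- the number of elements that are the least element of their orbit.
orbits : ∀ {n} → List (Fin n → Fin n) → ℕ
orbits {n} gs =
  countFin (λ x → not (anyFin (λ y → (toℕ y ℕ.<ᵇ toℕ x) ∧ reach gs n x y)))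

flip2 : Fin 2 → Fin 2
flip2 Fin.zero = Fin.suc Fin.zero
flip2 (Fin.suc _) = Fin.zero

-- Ribbon graphs as signed rotation systems.  Half-edges (edge-ends): Fin (nEdges * 2), the
-- half-edge combine e b being end b of edge e.  rot is the rotation
-- (cyclic order of half-edges around each vertex w.r.t. a chosen local
-- orientation of the vertex discs); its cycles are the vertices having at
-- least one incident edge.  nIsolated counts vertices with no incident edge.
-- twisted e says edge e is twisted relative to the vertex orientations.

record RibbonGraph : Set where
  field
    nEdges    : ℕ
    nIsolated : ℕ
    rot       : Permutation′ (nEdges * 2)
    twisted   : Fin nEdges → Bool

module _ (G : RibbonGraph) where
  open RibbonGraph G

  HalfEdge : Set
  HalfEdge = Fin (nEdges * 2)

  -- flags = (half-edge, side); side 0 faces rot⁻¹ h, side 1 faces rot h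
  Flag : Set
  Flag = Fin ((nEdges * 2) * 2)

  edgeOf : HalfEdge → Fin nEdges
  edgeOf h = proj₁ (remQuot {nEdges} 2 h)

  otherEnd : HalfEdge → HalfEdge
  otherEnd h = combine (proj₁ (remQuot {nEdges} 2 h)) (flip2 (proj₂ (remQuot {nEdges} 2 h)))

  rotF : HalfEdge → HalfEdge
  rotF h = rot ⟨$⟩ʳ h

  -- corner arcs of vertex boundaries
  cornerInv : Flag → Flag
  cornerInv x with remQuot {nEdges * 2} 2 x
  ... | h , Fin.zero    = combine (rot ⟨$⟩ˡ h) (Fin.suc Fin.zero)
  ... | h , Fin.suc _   = combine (rot ⟨$⟩ʳ h) Fin.zero

  -- edge-side arcs of edge boundaries
  edgeInv : Flag → Flag
  edgeInv x with remQuot {nEdges * 2} 2 x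
  ... | h , s = combine (otherEnd h) (if twisted (edgeOf h) then s else flip2 s)

  e : ℕ
  e = nEdges

  v : ℕ
  v = nIsolated ℕ.+ orbits (rotF ∷ [])

  f : ℕ
  f = nIsolated ℕ.+ orbits (cornerInv ∷ edgeInv ∷ [])

  c : ℕ
  c = nIsolated ℕ.+ orbits (rotF ∷ otherEnd ∷ [])

  eulerGenus : ℤ
  eulerGenus = + (2 * c) ℤ.- + v ℤ.+ + e ℤ.- + f

  Connected : Set
  Connected = c ≡ 1

  partialPetrial : Vec Bool nEdges → RibbonGraph
  partialPetrial A = record
    { nEdges = nEdges ; nIsolated = nIsolated ; rot = rot
    ; twisted = λ i → twisted i xor lookup A i }

allSubsets : ∀ m → List (Vec Bool m)
allSubsets zero    = [] ∷ []
allSubsets (suc m) = map (true ∷_) s ++ map (false ∷_) s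
  where s = allSubsets m

-- the partial Petrial polynomial, as its coefficient function:
-- coefficient of z^k is #{A ⊆ E(G) : ε(G^{×|A}) = k}
partialPetrialPoly : RibbonGraph → ℤ → ℕ
partialPetrialPoly G k =
  length (filter (λ A → eulerGenus (partialPetrial G A) ℤ.≟ k)
                 (allSubsets (RibbonGraph.nEdges G)))

HighestDegree : (ℤ → ℕ) → ℤ → Set
HighestDegree p d = (p d ≢ 0) × (∀ k → d ℤ.< k → p k ≡ 0)

-- For connected G, ε(G^{×A}) = e − v + 2 − f(G^{×A}) and f ≥ 1, so the claim is that some
-- partial Petrial has a single boundary component.  Boundary components are the orbits of
-- two fixed-point-free involutions on flags, the two sides of each half-edge: one follows
-- corner arcs around vertices, the other edge arcs.  Insert the edges one at a time,
-- keeping the two sides of every half-edge on a common boundary component; for a deleted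
-- edge this is witnessed by its attachment arc.  Walking along the boundary from a flag of
-- the new edge without crossing it reaches another of its four flags, and whichever flag
-- that is, one of the two twists keeps the invariant.  With all edges in, connectivity of
-- G puts every flag on the same boundary component.
module Submission where

open import Defs
open import Data.Bool using (Bool; true; false; T; not; _∧_; _∨_; _xor_; if_then_else_)
open import Data.Bool.ListAction using () renaming (any to anyL)
open import Data.Bool.Properties using (T-∧; T-∨; xor-assoc; xor-same)
open import Data.Empty using (⊥-elim)
open import Data.Fin as Fin using (Fin; zero; suc; toℕ; _≟_; combine; remQuot)
open import Data.Fin.Induction using (<-wellFounded)
open import Data.Fin.Patterns using (0F; 1F)
open import Data.Fin.Permutation using (_⟨$⟩ʳ_; _⟨$⟩ˡ_; inverseˡ; inverseʳ)
open import Data.Fin.Properties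
  using (all?; ¬∀⟶∃¬; pigeonhole; combine-remQuot; remQuot-combine; combine-injective; combine-injectiveʳ)
open import Data.Integer using (ℤ; +_; _+_; _-_)
import Data.Integer as ℤ
import Data.Integer.Properties as ℤ
open import Data.Integer.Solver using (module +-*-Solver)
open import Data.List using (List; []; _∷_; allFin; map; filter; length)
open import Data.List.Membership.Propositional using (_∈_)
open import Data.List.Membership.Propositional.Properties using (∈-allFin; ∈-filter⁺; ∈-map⁺; ∈-++⁺ˡ; ∈-++⁺ʳ)
open import Data.List.Properties using (filter-none)
open import Data.List.Relation.Binary.Pointwise using (Pointwise; []; _∷_)
open import Data.List.Relation.Unary.All as All using (All; []; _∷_)
open import Data.List.Relation.Unary.Any as Any using (Any; here; there)
open import Data.List.Relation.Unary.Any.Properties using (any⁺; any⁻)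
open import Data.Maybe using (Maybe; just; nothing)
open import Data.Nat as ℕ using (ℕ; zero; suc; _≤_; _<_; _≤′_; ≤′-refl; ≤′-step; z≤n; s≤s; _<ᵇ_)
open import Data.Nat.Properties
  using (≤-refl; ≤-antisym; ≤-trans; <-≤-trans; ≤-<-trans; <⇒≤; <⇒≱; ≤⇒≤′; n<1+n; m<n⇒m<1+n; n≮0;
         m≤m+n; m≤n+m; +-mono-≤; +-mono-<-≤; +-mono-≤-<; suc-injective; +-suc; +-identityʳ; m≤n⇒∃[o]m+o≡n; <ᵇ⇒<)
open import Data.Product using (∃-syntax; _×_; _,_; proj₁; proj₂; uncurry)
open import Data.Sum using (_⊎_; inj₁; inj₂)
open import Data.Vec using (Vec; []; _∷_; lookup; tabulate)
open import Data.Vec.Functional using (updateAt)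
open import Data.Vec.Functional.Properties using (updateAt-updates; updateAt-minimal)
open import Data.Vec.Properties using (lookup∘tabulate)
open import Function using (_∘_; id; case_of_; Equivalence)
open import Induction.WellFounded using (Acc; acc)
open import Relation.Binary.Construct.Closure.ReflexiveTransitive using (Star; ε; _◅_; _◅◅_; return; reverse; _⋆)
open import Relation.Binary.PropositionalEquality
  using (_≡_; _≢_; refl; sym; trans; cong; cong₂; subst; module ≡-Reasoning)
open import Relation.Nullary using (¬_; yes; no)
open import Relation.Nullary.Decidable using (toWitness; fromWitness)
open import Relation.Unary using (Decidable)

open Equivalence using (to; from)

private
  added : ∀ {a b} → (T a → T b) → b ≢ a → ¬ T a × T b
  added {false} {true}  _   _  = (λ ()) , _
  added {false} {false} _   b≢a = ⊥-elim (b≢a refl)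
  added {true}  {true}  _   b≢a = ⊥-elim (b≢a refl)
  added {true}  {false} a⇒b _   = ⊥-elim (a⇒b _)

  T-not⁺ : ∀ {b} → ¬ T b → T (not b)
  T-not⁺ {false} _  = _
  T-not⁺ {true}  ¬b = ¬b _

  T⇒¬T-not : ∀ {b} → T b → ¬ T (not b)
  T⇒¬T-not {true} _ ()

  ¬T-not⇒T : ∀ {b} → ¬ T (not b) → T b
  ¬T-not⇒T {false} ¬t = ¬t _
  ¬T-not⇒T {true}  _  = _

  indicator-mono : ∀ {a b} → (T a → T b) → (if a then 1 else 0) ≤ (if b then 1 else 0)
  indicator-mono {false}         _ = z≤n
  indicator-mono {true}  {true}  _ = ≤-refl
  indicator-mono {true}  {false} a⇒b = ⊥-elim (a⇒b _)

  indicator-< : ∀ {a b} → ¬ T a → T b → (if a then 1 else 0) < (if b then 1 else 0)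
  indicator-< {false} {true}  _  _ = s≤s z≤n
  indicator-< {true}          ¬a _ = ⊥-elim (¬a _)

anyFin⁺ : ∀ {n} (p : Fin n → Bool) {z} → T (p z) → T (anyFin p)
anyFin⁺ p {zero}  pz = T-∨ .from (inj₁ pz)
anyFin⁺ p {suc z} pz = T-∨ .from (inj₂ (anyFin⁺ (p ∘ suc) pz))

anyFin⁻ : ∀ {n} (p : Fin n → Bool) → T (anyFin p) → ∃[ z ] T (p z)
anyFin⁻ {suc n} p h with T-∨ .to h
... | inj₁ p₀ = zero , p₀
... | inj₂ ps with anyFin⁻ (p ∘ suc) ps
...   | z , pz = suc z , pz

anyFin-cong : ∀ {n} {p q : Fin n → Bool} → (∀ z → p z ≡ q z) → anyFin p ≡ anyFin q
anyFin-cong {zero}  _   = refl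
anyFin-cong {suc n} p≗q = cong₂ _∨_ (p≗q zero) (anyFin-cong (p≗q ∘ suc))

countFin≤n : ∀ {n} (p : Fin n → Bool) → countFin p ≤ n
countFin≤n {zero}  p = z≤n
countFin≤n {suc n} p = +-mono-≤ (indicator-mono {b = true} _) (countFin≤n (p ∘ suc))

countFin-mono : ∀ {n} {p q : Fin n → Bool} → (∀ {z} → T (p z) → T (q z)) → countFin p ≤ countFin q
countFin-mono {zero}  p⊆q = z≤n
countFin-mono {suc n} {p} {q} p⊆q = +-mono-≤ (indicator-mono p⊆q) (countFin-mono {p = p ∘ suc} {q ∘ suc} p⊆q)

countFin-mono-< : ∀ {n} {p q : Fin n → Bool} → (∀ {z} → T (p z) → T (q z)) →
                  ∀ z → ¬ T (p z) → T (q z) → countFin p < countFin q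
countFin-mono-< {p = p} {q} p⊆q zero    ¬pz qz =
  +-mono-<-≤ (indicator-< ¬pz qz) (countFin-mono {p = p ∘ suc} {q ∘ suc} p⊆q)
countFin-mono-< {p = p} {q} p⊆q (suc z) ¬pz qz =
  +-mono-≤-< (indicator-mono p⊆q) (countFin-mono-< {p = p ∘ suc} {q ∘ suc} p⊆q z ¬pz qz)

countFin-pos : ∀ {n} (p : Fin n → Bool) {z} → T (p z) → 0 < countFin p
countFin-pos p {zero}  pz = <-≤-trans (indicator-< {false} id pz) (m≤m+n _ _)
countFin-pos p {suc z} pz = <-≤-trans (countFin-pos (p ∘ suc) pz) (m≤n+m _ _)

countFin-suc : ∀ {n} (p : Fin (suc n) → Bool) → T (p zero) → countFin p ≡ suc (countFin (p ∘ suc))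
countFin-suc p p₀ with p zero
... | true = refl

countFin≡0 : ∀ {n} (p : Fin n → Bool) → countFin p ≡ 0 → ∀ z → ¬ T (p z)
countFin≡0 p none z pz = n≮0 (subst (0 <_) none (countFin-pos p pz))

countFin-none : ∀ {n} (p : Fin n → Bool) → (∀ z → ¬ T (p z)) → countFin p ≡ 0
countFin-none {zero}  p none = refl
countFin-none {suc n} p none with p zero | none zero
... | false | _  = countFin-none (p ∘ suc) (none ∘ suc)
... | true  | ¬t = ⊥-elim (¬t _)

module _ {A : Set} where

  Step : List (A → A) → A → A → Set
  Step gs x y = Any (λ g → g x ≡ y) gs

  Path : List (A → A) → A → A → Set
  Path gs = Star (Step gs)

  path-sym : ∀ {gs} → All (λ g → ∀ x → g (g x) ≡ x) gs → ∀ {x y} → Path gs x y → Path gs y x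
  path-sym involutive = reverse (step-sym involutive)
    where
    step-sym : ∀ {hs} → All (λ g → ∀ x → g (g x) ≡ x) hs → ∀ {x y} → Step hs x y → Step hs y x
    step-sym (inv ∷ _)    (here refl) = here (inv _)
    step-sym (_ ∷ invs) (there s)   = there (step-sym invs s)

  path-cong : ∀ {gs hs} → Pointwise (λ g h → ∀ x → g x ≡ h x) gs hs → ∀ {x y} → Path gs x y → Path hs x y
  path-cong gs≗hs = (return ∘ step-cong gs≗hs) ⋆
    where
    step-cong : ∀ {gs hs} → Pointwise (λ g h → ∀ x → g x ≡ h x) gs hs → ∀ {x y} → Step gs x y → Step hs x y
    step-cong (g≗h ∷ _)  (here refl) = here (sym (g≗h _))
    step-cong (_ ∷ gs≗hs) (there s)   = there (step-cong gs≗hs s)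

module Reachability {n : ℕ} (gs : List (Fin n → Fin n)) where

  private
    step⁺ : ∀ {z y} → Step gs z y → T (anyL (λ g → g z == y) gs)
    step⁺ s = any⁺ _ (Any.map fromWitness s)

    step⁻ : ∀ {z y} → T (anyL (λ g → g z == y) gs) → Step gs z y
    step⁻ h = Any.map toWitness (any⁻ _ gs h)

  reach-sound : ∀ k {x y} → T (reach gs k x y) → Path gs x y
  reach-sound zero {x} {y} h with toWitness {a? = x ≟ y} h
  ... | refl = ε
  reach-sound (suc k) {x} {y} h with T-∨ .to h
  ... | inj₁ r = reach-sound k r
  ... | inj₂ r with anyFin⁻ (λ z → reach gs k x z ∧ anyL (λ g → g z == y) gs) r
  ...   | z , rz with T-∧ .to rz
  ...     | xz , zy = reach-sound k xz ◅◅ return (step⁻ zy)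

  reach-mono : ∀ k {x y} → T (reach gs k x y) → T (reach gs (suc k) x y)
  reach-mono k r = T-∨ .from (inj₁ r)

  reach-step : ∀ k {x z y} → T (reach gs k x z) → Step gs z y → T (reach gs (suc k) x y)
  reach-step k {x} {z} {y} xz s =
    T-∨ .from (inj₂ (anyFin⁺ (λ w → reach gs k x w ∧ anyL (λ g → g w == y) gs) (T-∧ .from (xz , step⁺ s))))

  reach-extend : ∀ k {x z y} → T (reach gs k x z) → Path gs z y → ∃[ m ] T (reach gs m x y)
  reach-extend k xz ε       = k , xz
  reach-extend k xz (s ◅ p) = reach-extend (suc k) (reach-step k xz s) p

module Saturation {n : ℕ} (R : ℕ → Fin n → Bool)
  (R-mono : ∀ k {y} → T (R k y) → T (R (suc k) y))
  (R-next : ∀ {j k} → (∀ y → R j y ≡ R k y) → ∀ y → R (suc j) y ≡ R (suc k) y)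
  {y₀ : Fin n} (y₀∈R₀ : T (R 0 y₀)) where

  Stationary : ℕ → Set
  Stationary j = ∀ y → R (suc j) y ≡ R j y

  stationary-after : ∀ {j m} → Stationary j → j ≤′ m → ∀ y → R m y ≡ R j y
  stationary-after st ≤′-refl        y = refl
  stationary-after st (≤′-step j≤m) y = trans (R-next (stationary-after st j≤m) y) (st y)

  R-mono′ : ∀ {k m} → k ≤′ m → ∀ {y} → T (R k y) → T (R m y)
  R-mono′ ≤′-refl        = id
  R-mono′ (≤′-step k≤m) = R-mono _ ∘ R-mono′ k≤m

  stationary-or-growing : ∀ k → (∃[ j ] j < k × Stationary j) ⊎ k < countFin (R k)
  stationary-or-growing zero = inj₂ (countFin-pos (R 0) y₀∈R₀)
  stationary-or-growing (suc k) with stationary-or-growing k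
  ... | inj₁ (j , j<k , st) = inj₁ (j , m<n⇒m<1+n j<k , st)
  ... | inj₂ k<count with all? (λ y → R (suc k) y Data.Bool.≟ R k y)
  ...   | yes st  = inj₁ (k , n<1+n k , st)
  ...   | no ¬st with ¬∀⟶∃¬ n _ (λ y → R (suc k) y Data.Bool.≟ R k y) ¬st
  ...     | y , changed with added (R-mono k) changed
  ...       | y∉Rk , y∈Rsk = inj₂ (≤-<-trans k<count (countFin-mono-< (R-mono k) y y∉Rk y∈Rsk))

  saturated : ∀ {k y} → T (R k y) → T (R n y)
  saturated {k} {y} y∈Rk with stationary-or-growing n
  ... | inj₂ n<count = ⊥-elim (<⇒≱ n<count (countFin≤n (R n)))
  ... | inj₁ (j , j<n , st) =
    subst T (trans (stationary-after st (≤⇒≤′ (≤-trans (<⇒≤ j<n) (m≤m+n n k))) y)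
                   (sym (stationary-after st (≤⇒≤′ (<⇒≤ j<n)) y)))
          (R-mono′ (≤⇒≤′ (m≤n+m k n)) y∈Rk)

module _ {n : ℕ} (gs : List (Fin n → Fin n)) where
  open Reachability gs

  reach-complete : ∀ {x y} → Path gs x y → T (reach gs n x y)
  reach-complete {x} p = let m , r = reach-extend 0 (fromWitness {a? = x ≟ x} refl) p in saturated {m} r
    where
    open Saturation (λ k → reach gs k x) (λ k → reach-mono k)
      (λ {j} Rj≗Rk y → cong₂ _∨_ (Rj≗Rk y) (anyFin-cong (λ z → cong (_∧ _) (Rj≗Rk z))))
      (fromWitness {a? = x ≟ x} refl)

module _ {n : ℕ} (gs : List (Fin (suc n) → Fin (suc n))) where
  open Reachability gs

  private
    leastInOrbit : Fin (suc n) → Bool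
    leastInOrbit x = not (anyFin (λ y → (toℕ y <ᵇ toℕ x) ∧ reach gs (suc n) x y))

    zero-least : T (leastInOrbit zero)
    zero-least = T-not⁺ λ h → proj₂ (anyFin⁻ (λ y → (toℕ y <ᵇ 0) ∧ reach gs (suc n) zero y) h)

    orbits≡1+rest : orbits gs ≡ suc (countFin (leastInOrbit ∘ suc))
    orbits≡1+rest = countFin-suc (leastInOrbit) zero-least

  orbits-pos : 0 < orbits gs
  orbits-pos = countFin-pos (leastInOrbit) {zero} zero-least

  orbits≡1 : (∀ x y → Path gs x y) → orbits gs ≡ 1
  orbits≡1 connected = trans orbits≡1+rest (cong suc (countFin-none (leastInOrbit ∘ suc) not-least))
    where
    not-least : ∀ i → ¬ T (leastInOrbit (suc i))
    not-least i = T⇒¬T-not (anyFin⁺ (λ y → (toℕ y <ᵇ toℕ (suc i)) ∧ reach gs (suc n) (suc i) y) {zero}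
                                  (reach-complete gs (connected (suc i) zero)))

  orbits≡1⇒path-to-zero : orbits gs ≡ 1 → ∀ x → Path gs x zero
  orbits≡1⇒path-to-zero one x = go x (<-wellFounded x)
    where
    not-least : ∀ i → ¬ T (leastInOrbit (suc i))
    not-least = countFin≡0 (leastInOrbit ∘ suc) (suc-injective (trans (sym orbits≡1+rest) one))

    go : ∀ x → Acc Fin._<_ x → Path gs x zero
    go zero    _        = ε
    go (suc i) (acc rs) with anyFin⁻ _ (¬T-not⇒T (not-least i))
    ... | y , h with T-∧ .to h
    ...   | y<x , x⟶y = reach-sound (suc n) x⟶y ◅◅ go y (rs (<ᵇ⇒< (toℕ y) (toℕ (suc i)) y<x))

-- Walks avoiding a set

data Halves : ℕ → Set where
  even : ∀ m → Halves (m ℕ.+ m)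
  odd  : ∀ m → Halves (suc (m ℕ.+ m))

halves : ∀ k → Halves k
halves zero = even 0
halves (suc k) with halves k
... | even m = odd m
... | odd m  = subst (Halves ∘ suc) (+-suc m m) (even (suc m))

module AvoidingWalk {N : ℕ} (c ι : Fin N → Fin N)
  (c-involutive : ∀ x → c (c x) ≡ x) (ι-involutive : ∀ x → ι (ι x) ≡ x)
  (c-fixpoint-free : ∀ x → c x ≢ x) (ι-fixpoint-free : ∀ x → ι x ≢ x)
  {D : Fin N → Set} (D? : Decidable D) (ι-preserves-D : ∀ {x} → D x → D (ι x)) where

  data AvoidingStep (x : Fin N) : Fin N → Set where
    corner : AvoidingStep x (c x)
    edge   : ¬ D x → AvoidingStep x (ι x)

  avoiding⇒path : ∀ {ι′} → (∀ x → ¬ D x → ι′ x ≡ ι x) →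
                  ∀ {x y} → Star AvoidingStep x y → Path (c ∷ ι′ ∷ []) x y
  avoiding⇒path {ι′} agree = (return ∘ step) ⋆
    where
    step : ∀ {x y} → AvoidingStep x y → Step (c ∷ ι′ ∷ []) x y
    step corner     = here refl
    step (edge x∉D) = there (here (agree _ x∉D))

  private
    φ : Fin N → Fin N
    φ = ι ∘ c

    φ-injective : ∀ {x y} → φ x ≡ φ y → x ≡ y
    φ-injective {x} {y} φx≡φy = begin
      x           ≡⟨ sym (c-involutive x) ⟩
      c (c x)     ≡⟨ cong c (sym (ι-involutive (c x))) ⟩
      c (ι (φ x)) ≡⟨ cong (c ∘ ι) φx≡φy ⟩
      c (ι (φ y)) ≡⟨ cong c (ι-involutive (c y)) ⟩
      c (c y)     ≡⟨ c-involutive y ⟩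
      y           ∎
      where open ≡-Reasoning

  module _ (u : Fin N) where

    orbit : ℕ → Fin N
    orbit zero    = u
    orbit (suc j) = φ (orbit j)

    private
      orbit-cancel : ∀ i m → orbit (suc (i ℕ.+ m)) ≡ orbit i → orbit (suc m) ≡ u
      orbit-cancel zero    m eq = eq
      orbit-cancel (suc i) m eq = orbit-cancel i m (φ-injective eq)

      orbit-returns : ∃[ d ] orbit (suc d) ≡ u
      orbit-returns with pigeonhole (n<1+n N) (orbit ∘ toℕ)
      ... | i , j , i<j , same with m≤n⇒∃[o]m+o≡n i<j
      ...   | d , 1+i+d≡j = d , orbit-cancel (toℕ i) d (trans (cong orbit 1+i+d≡j) (sym same))

      -- A walk that closes up with c would be a palindrome, forcing a fixed point.
      mirror : ∀ i j → c (orbit (i ℕ.+ j)) ≡ u → c (orbit i) ≡ orbit j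
      mirror i zero    eq = subst (λ k → c (orbit k) ≡ u) (+-identityʳ i) eq
      mirror i (suc j) eq = begin
        c (orbit i)                 ≡⟨ sym (ι-involutive _) ⟩
        ι (ι (c (orbit i)))         ≡⟨ cong ι (sym (c-involutive _)) ⟩
        ι (c (c (orbit (suc i))))   ≡⟨ cong φ (mirror (suc i) j (subst (λ k → c (orbit k) ≡ u) (+-suc i j) eq)) ⟩
        φ (orbit j)                 ∎
        where open ≡-Reasoning

      c-orbit≢start : ∀ k → c (orbit k) ≢ u
      c-orbit≢start k eq with halves k
      ... | even m = c-fixpoint-free (orbit m) (mirror m m eq)
      ... | odd m  = ι-fixpoint-free (c (orbit m)) (begin
        ι (c (orbit m))             ≡⟨ sym (c-involutive _) ⟩
        c (c (orbit (suc m)))       ≡⟨ cong c (mirror (suc m) m eq) ⟩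
        c (orbit m)                 ∎)
        where open ≡-Reasoning

      Found : Set
      Found = ∃[ X ] D X × X ≢ u × Star AvoidingStep u X

      walk-prefix : ∀ j → Found ⊎ Star AvoidingStep u (orbit j)
      walk-prefix zero = inj₂ ε
      walk-prefix (suc j) with walk-prefix j
      ... | inj₁ found = inj₁ found
      ... | inj₂ p with D? (c (orbit j))
      ...   | yes hit  = inj₁ (c (orbit j) , hit , c-orbit≢start j , p ◅◅ return corner)
      ...   | no  miss = inj₂ (p ◅◅ corner ◅ edge miss ◅ ε)

    walk : D u → ∃[ X ] D X × X ≢ u × Star AvoidingStep u X
    walk u∈D with orbit-returns
    ... | d , returns with walk-prefix d
    ...   | inj₁ found = found
    ...   | inj₂ p     = c (orbit d) , subst D (sym hits-ιu) (ι-preserves-D u∈D) , c-orbit≢start d , p ◅◅ return corner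
      where
      hits-ιu : c (orbit d) ≡ ι u
      hits-ιu = trans (sym (ι-involutive _)) (cong ι returns)

-- Flags of a ribbon graph and insertion of edges

-- R t p q: the flags p, q = (end, side) of an edge inserted with twist t lie on a common
-- boundary component.  The fourth hypothesis is the edge itself, the last two are
-- boundary walks that avoid it.
choose-twist : (R : Bool → Fin 2 × Fin 2 → Fin 2 × Fin 2 → Set) →
  (∀ {t p q} → R t p q → R t q p) →
  (∀ {t p q r} → R t p q → R t q r → R t p r) →
  (∀ t b s → R t (b , s) (flip2 b , (if t then s else flip2 s))) →
  (∃[ p ] p ≢ (0F , 1F) × ∀ t → R t (0F , 1F) p) →
  (∃[ p ] p ≢ (1F , 1F) × ∀ t → R t (1F , 1F) p) →
  ∃[ t ] R t (0F , 0F) (0F , 1F) × R t (1F , 0F) (1F , 1F)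
choose-twist R sym′ _∙_ arc (p , p≢ , w) (q , q≢ , w′) with p | p≢ | w
... | 0F , 1F | p≢ | _ = ⊥-elim (p≢ refl)
... | 1F , 0F | _ | w = true  , arc true 0F 0F ∙ sym′ (w true) , sym′ (w true) ∙ arc true 0F 1F
... | 1F , 1F | _ | w = false , arc false 0F 0F ∙ sym′ (w false) , arc false 1F 0F ∙ w false
... | 0F , 0F | _ | w with q | q≢ | w′
...   | 1F , 1F | q≢ | _  = ⊥-elim (q≢ refl)
...   | 1F , 0F | _  | w′ = true  , sym′ (w true)  , sym′ (w′ true)
...   | 0F , 0F | _  | w′ = true  , sym′ (w true)  , arc true 1F 0F ∙ sym′ (w′ true)
...   | 0F , 1F | _  | w′ = false , sym′ (w false) , arc false 1F 0F ∙ sym′ (w′ false)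

data Combined {m n : ℕ} : Fin (m ℕ.* n) → Set where
  combined : ∀ (i : Fin m) (j : Fin n) → Combined (combine i j)

combined-view : ∀ {m n} (k : Fin (m ℕ.* n)) → Combined {m} {n} k
combined-view {m} {n} k = subst Combined (combine-remQuot {m} n k) (combined (proj₁ (remQuot {m} n k)) (proj₂ (remQuot {m} n k)))

flip2-involutive : ∀ s → flip2 (flip2 s) ≡ s
flip2-involutive 0F = refl
flip2-involutive 1F = refl

module _ (G : RibbonGraph) where
  open RibbonGraph G

  flag : Fin nEdges → Fin 2 × Fin 2 → Flag G
  flag e (b , s) = combine (combine e b) s

  data FlagView : Flag G → Set where
    flag-view : ∀ e p → FlagView (flag e p)

  flagView : ∀ x → FlagView x
  flagView x with combined-view {nEdges ℕ.* 2} {2} x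
  ... | combined h s with combined-view {nEdges} {2} h
  ...   | combined e b = flag-view e (b , s)

  flag-injective : ∀ {e e′ p p′} → flag e p ≡ flag e′ p′ → e ≡ e′ × p ≡ p′
  flag-injective {e} {e′} {b , s} {b′ , s′} eq
    with combine-injective (combine e b) s (combine e′ b′) s′ eq
  ... | h≡h′ , refl with combine-injective e b e′ b′ h≡h′
  ...   | refl , refl = refl , refl

  flagEdge : Flag G → Fin nEdges
  flagEdge x = proj₁ (remQuot {nEdges} 2 (proj₁ (remQuot {nEdges ℕ.* 2} 2 x)))

  flagEdge-flag : ∀ e p → flagEdge (flag e p) ≡ e
  flagEdge-flag e (b , s) =
    trans (cong (λ r → proj₁ (remQuot {nEdges} 2 (proj₁ r))) (remQuot-combine {nEdges ℕ.* 2} {2} (combine e b) s))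
          (cong proj₁ (remQuot-combine {nEdges} {2} e b))

  edgeOf-combine : ∀ e b → edgeOf G (combine e b) ≡ e
  edgeOf-combine e b = cong proj₁ (remQuot-combine {nEdges} {2} e b)

  otherEnd-combine : ∀ e b → otherEnd G (combine e b) ≡ combine e (flip2 b)
  otherEnd-combine e b = cong (λ r → combine (proj₁ r) (flip2 (proj₂ r))) (remQuot-combine {nEdges} {2} e b)

  cornerArc : HalfEdge G × Fin 2 → Flag G
  cornerArc (h , 0F) = combine (rot ⟨$⟩ˡ h) 1F
  cornerArc (h , 1F) = combine (rot ⟨$⟩ʳ h) 0F

  private
    cornerInv≡cornerArc : ∀ x → cornerInv G x ≡ cornerArc (remQuot {nEdges ℕ.* 2} 2 x)
    cornerInv≡cornerArc x with remQuot {nEdges ℕ.* 2} 2 x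
    ... | h , 0F = refl
    ... | h , 1F = refl

  cornerInv-combine : ∀ h s → cornerInv G (combine h s) ≡ cornerArc (h , s)
  cornerInv-combine h s = trans (cornerInv≡cornerArc (combine h s)) (cong cornerArc (remQuot-combine {nEdges ℕ.* 2} {2} h s))

  edgeInv-flag : ∀ e b s → edgeInv G (flag e (b , s)) ≡ flag e (flip2 b , (if twisted e then s else flip2 s))
  edgeInv-flag e b s = begin
    edgeInv G (flag e (b , s))
      ≡⟨ cong edgeArc (remQuot-combine {nEdges ℕ.* 2} {2} (combine e b) s) ⟩
    combine (otherEnd G (combine e b)) (if twisted (edgeOf G (combine e b)) then s else flip2 s)
      ≡⟨ cong₂ (λ h e′ → combine h (if twisted e′ then s else flip2 s)) (otherEnd-combine e b) (edgeOf-combine e b) ⟩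
    flag e (flip2 b , (if twisted e then s else flip2 s)) ∎
    where
    open ≡-Reasoning
    edgeArc : HalfEdge G × Fin 2 → Flag G
    edgeArc (h , s) = combine (otherEnd G h) (if twisted (edgeOf G h) then s else flip2 s)

  cornerInv-involutive : ∀ x → cornerInv G (cornerInv G x) ≡ x
  cornerInv-involutive x with combined-view {nEdges ℕ.* 2} {2} x
  ... | combined h 0F = trans (cong (cornerInv G) (cornerInv-combine h 0F))
                              (trans (cornerInv-combine _ 1F) (cong (λ h′ → combine h′ 0F) (inverseʳ rot)))
  ... | combined h 1F = trans (cong (cornerInv G) (cornerInv-combine h 1F))
                              (trans (cornerInv-combine _ 0F) (cong (λ h′ → combine h′ 1F) (inverseˡ rot)))

  cornerInv-fixpoint-free : ∀ x → cornerInv G x ≢ x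
  cornerInv-fixpoint-free x with combined-view {nEdges ℕ.* 2} {2} x
  ... | combined h 0F = λ eq → case combine-injectiveʳ (rot ⟨$⟩ˡ h) 1F h 0F (trans (sym (cornerInv-combine h 0F)) eq) of λ ()
  ... | combined h 1F = λ eq → case combine-injectiveʳ (rot ⟨$⟩ʳ h) 0F h 1F (trans (sym (cornerInv-combine h 1F)) eq) of λ ()

  -- nothing: the edge is deleted, and along its attachment arc the boundary passes
  -- from one side of the half-edge to the other; just t: present with twist t.
  SignedSubgraph : Set
  SignedSubgraph = Fin nEdges → Maybe Bool

  arcEnds : Maybe Bool → Fin 2 × Fin 2 → Fin 2 × Fin 2
  arcEnds nothing  (b , s) = b , flip2 s
  arcEnds (just t) (b , s) = flip2 b , (if t then s else flip2 s)

  arcEnds-involutive : ∀ m p → arcEnds m (arcEnds m p) ≡ p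
  arcEnds-involutive nothing      (b , s) = cong (b ,_) (flip2-involutive s)
  arcEnds-involutive (just true)  (b , s) = cong (_, s) (flip2-involutive b)
  arcEnds-involutive (just false) (b , s) = cong₂ _,_ (flip2-involutive b) (flip2-involutive s)

  arcEnds-fixpoint-free : ∀ m p → arcEnds m p ≢ p
  arcEnds-fixpoint-free nothing  (b , 0F) ()
  arcEnds-fixpoint-free nothing  (b , 1F) ()
  arcEnds-fixpoint-free (just t) (0F , s) ()
  arcEnds-fixpoint-free (just t) (1F , s) ()

  edgeInvOf : SignedSubgraph → Flag G → Flag G
  edgeInvOf S = uncurry arc ∘ remQuot {nEdges ℕ.* 2} 2
    where
    arc : HalfEdge G → Fin 2 → Flag G
    arc h s = uncurry (λ e b → flag e (arcEnds (S e) (b , s))) (remQuot {nEdges} 2 h)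

  edgeInvOf-flag : ∀ S e p → edgeInvOf S (flag e p) ≡ flag e (arcEnds (S e) p)
  edgeInvOf-flag S e (b , s) =
    trans (cong (uncurry λ h s → uncurry (λ e b → flag e (arcEnds (S e) (b , s))) (remQuot {nEdges} 2 h))
                (remQuot-combine {nEdges ℕ.* 2} {2} (combine e b) s))
          (cong (uncurry λ e b → flag e (arcEnds (S e) (b , s))) (remQuot-combine {nEdges} {2} e b))

  edgeInvOf-involutive : ∀ S x → edgeInvOf S (edgeInvOf S x) ≡ x
  edgeInvOf-involutive S x with flagView x
  ... | flag-view e p = begin
    edgeInvOf S (edgeInvOf S (flag e p))     ≡⟨ cong (edgeInvOf S) (edgeInvOf-flag S e p) ⟩
    edgeInvOf S (flag e (arcEnds (S e) p))   ≡⟨ edgeInvOf-flag S e _ ⟩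
    flag e (arcEnds (S e) (arcEnds (S e) p)) ≡⟨ cong (flag e) (arcEnds-involutive (S e) p) ⟩
    flag e p                                 ∎
    where open ≡-Reasoning

  edgeInvOf-fixpoint-free : ∀ S x → edgeInvOf S x ≢ x
  edgeInvOf-fixpoint-free S x with flagView x
  ... | flag-view e p = arcEnds-fixpoint-free (S e) p ∘ proj₂ ∘ flag-injective ∘ trans (sym (edgeInvOf-flag S e p))

  flagEdge-edgeInvOf : ∀ S x → flagEdge (edgeInvOf S x) ≡ flagEdge x
  flagEdge-edgeInvOf S x with flagView x
  ... | flag-view e p = trans (cong flagEdge (edgeInvOf-flag S e p)) (trans (flagEdge-flag e _) (sym (flagEdge-flag e p)))

  Linked : SignedSubgraph → Flag G → Flag G → Set
  Linked S = Path (cornerInv G ∷ edgeInvOf S ∷ [])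

  linked-sym : ∀ S {x y} → Linked S x y → Linked S y x
  linked-sym S = path-sym (cornerInv-involutive ∷ edgeInvOf-involutive S ∷ [])

  edge-link : ∀ S {x y} → edgeInvOf S x ≡ y → Linked S x y
  edge-link S eq = return (there (here eq))

  SidesLinked : SignedSubgraph → Set
  SidesLinked S = ∀ (h : HalfEdge G) → Linked S (combine h 0F) (combine h 1F)

  sidesLinked-empty : SidesLinked (λ _ → nothing)
  sidesLinked-empty h with combined-view {nEdges} {2} h
  ... | combined e b = edge-link (λ _ → nothing) (edgeInvOf-flag (λ _ → nothing) e (b , 0F))

  module Insertion (S : SignedSubgraph) (e₀ : Fin nEdges) (e₀-absent : S e₀ ≡ nothing)
                   (sides : SidesLinked S) where

    inserted : Bool → SignedSubgraph
    inserted t = updateAt S e₀ (λ _ → just t)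

    edgeInvOf-inserted-on : ∀ t p → edgeInvOf (inserted t) (flag e₀ p) ≡ flag e₀ (arcEnds (just t) p)
    edgeInvOf-inserted-on t p = trans (edgeInvOf-flag (inserted t) e₀ p) (cong (λ m → flag e₀ (arcEnds m p)) (updateAt-updates e₀ S))

    edgeInvOf-inserted-off : ∀ t {e} p → e ≢ e₀ → edgeInvOf (inserted t) (flag e p) ≡ edgeInvOf S (flag e p)
    edgeInvOf-inserted-off t {e} p e≢e₀ =
      trans (edgeInvOf-flag (inserted t) e p) (trans (cong (λ m → flag e (arcEnds m p)) (updateAt-minimal e e₀ S e≢e₀))
                                          (sym (edgeInvOf-flag S e p)))

    open AvoidingWalk (cornerInv G) (edgeInvOf S) cornerInv-involutive (edgeInvOf-involutive S)
      cornerInv-fixpoint-free (edgeInvOf-fixpoint-free S) {λ x → flagEdge x ≡ e₀} (λ x → flagEdge x ≟ e₀)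
      (trans (flagEdge-edgeInvOf S _))

    walk-to-other-flag : ∀ p₀ → ∃[ p ] p ≢ p₀ × ∀ t → Linked (inserted t) (flag e₀ p₀) (flag e₀ p)
    walk-to-other-flag p₀ with walk (flag e₀ p₀) (flagEdge-flag e₀ p₀)
    ... | X , X-on-e₀ , X≢start , path with flagView X
    ...   | flag-view e p with trans (sym (flagEdge-flag e p)) X-on-e₀
    ...     | refl = p , X≢start ∘ cong (flag e₀) , λ t → avoiding⇒path (agree t) path
      where
      agree : ∀ t x → flagEdge x ≢ e₀ → edgeInvOf (inserted t) x ≡ edgeInvOf S x
      agree t x off with flagView x
      ... | flag-view e p = edgeInvOf-inserted-off t p (off ∘ trans (flagEdge-flag e p))

    EndLinks : Bool → Fin 2 × Fin 2 → Fin 2 × Fin 2 → Set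
    EndLinks t p q = Linked (inserted t) (flag e₀ p) (flag e₀ q)

    twist-choice : ∃[ t ] EndLinks t (0F , 0F) (0F , 1F) × EndLinks t (1F , 0F) (1F , 1F)
    twist-choice = choose-twist EndLinks (λ {t} → linked-sym (inserted t)) _◅◅_
      (λ t b s → edge-link (inserted t) (edgeInvOf-inserted-on t (b , s)))
      (walk-to-other-flag (0F , 1F)) (walk-to-other-flag (1F , 1F))

    sidesLinked-inserted : ∀ t → (∀ b → EndLinks t (b , 0F) (b , 1F)) → SidesLinked (inserted t)
    sidesLinked-inserted t ends = old-step ⋆ ∘ sides
      where
      crossing : ∀ p → Linked (inserted t) (flag e₀ p) (flag e₀ (arcEnds nothing p))
      crossing (b , 0F) = ends b
      crossing (b , 1F) = linked-sym (inserted t) (ends b)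

      old-step : ∀ {x y} → Step (cornerInv G ∷ edgeInvOf S ∷ []) x y → Linked (inserted t) x y
      old-step (here eq) = return (here eq)
      old-step {x} (there (here refl)) with flagView x
      ... | flag-view e p with e ≟ e₀
      ...   | no e≢e₀ = edge-link (inserted t) (edgeInvOf-inserted-off t p e≢e₀)
      ...   | yes refl = subst (Linked (inserted t) (flag e₀ p))
                               (sym (trans (edgeInvOf-flag S e₀ p) (cong (λ m → flag e₀ (arcEnds m p)) e₀-absent)))
                               (crossing p)

    insert : ∃[ t ] SidesLinked (inserted t)
    insert = let t , end₀ , end₁ = twist-choice in t , sidesLinked-inserted t λ { 0F → end₀ ; 1F → end₁ }

  AllPresent : SignedSubgraph → Set
  AllPresent S = ∀ e → ∃[ t ] S e ≡ just t

  insert-all : ∀ (es : List (Fin nEdges)) S → SidesLinked S → (∀ e → S e ≡ nothing → e ∈ es) →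
               ∃[ S′ ] SidesLinked S′ × AllPresent S′
  insert-all [] S sides absent⊆[] = S , sides , all-present
    where
    all-present : AllPresent S
    all-present e with S e in Se≡
    ... | just t  = t , refl
    ... | nothing with () ← absent⊆[] e Se≡
  insert-all (e₀ ∷ es) S sides absent⊆ with S e₀ in Se₀≡
  ... | just t₀ = insert-all es S sides absent⊆es
    where
    absent⊆es : ∀ e → S e ≡ nothing → e ∈ es
    absent⊆es e absent with absent⊆ e absent
    ... | here refl = case trans (sym Se₀≡) absent of λ ()
    ... | there e∈es = e∈es
  ... | nothing = let t , sides′ = Insertion.insert S e₀ Se₀≡ sides in
                  insert-all es (updateAt S e₀ (λ _ → just t)) sides′ (absent⊆es t)
    where
    absent⊆es : ∀ t e → updateAt S e₀ (λ _ → just t) e ≡ nothing → e ∈ es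
    absent⊆es t e absent with e ≟ e₀
    ... | yes refl = case trans (sym (updateAt-updates e₀ S)) absent of λ ()
    ... | no e≢e₀ with absent⊆ e (trans (sym (updateAt-minimal e e₀ S e≢e₀)) absent)
    ...   | here e≡e₀  = ⊥-elim (e≢e₀ e≡e₀)
    ...   | there e∈es = e∈es

  module _ (S : SignedSubgraph) (sides : SidesLinked S) (all-present : AllPresent S) where

    sides-linked : ∀ (h : HalfEdge G) (s s′ : Fin 2) → Linked S (combine h s) (combine h s′)
    sides-linked h 0F 0F = ε
    sides-linked h 0F 1F = sides h
    sides-linked h 1F 0F = linked-sym S (sides h)
    sides-linked h 1F 1F = ε

    half-edge-step-linked : ∀ {h h′} → Step (rotF G ∷ otherEnd G ∷ []) h h′ →
                            ∃[ s ] ∃[ s′ ] Linked S (combine {n = 2} h s) (combine h′ s′)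
    half-edge-step-linked {h} (here refl) = 1F , 0F , return (here (cornerInv-combine h 1F))
    half-edge-step-linked {h} (there (here refl)) with combined-view {nEdges} {2} h
    ... | combined e b with all-present e
    ...   | t , Se≡ = 0F , (if t then 0F else 1F) , edge-link S (begin
      edgeInvOf S (flag e (b , 0F))             ≡⟨ edgeInvOf-flag S e (b , 0F) ⟩
      flag e (arcEnds (S e) (b , 0F))           ≡⟨ cong (λ m → flag e (arcEnds m (b , 0F))) Se≡ ⟩
      flag e (arcEnds (just t) (b , 0F))        ≡⟨ cong (λ h′ → combine h′ _) (sym (otherEnd-combine e b)) ⟩
      combine (otherEnd G (combine e b)) _      ∎)
      where open ≡-Reasoning

    half-edges-linked : ∀ {h h′} → Path (rotF G ∷ otherEnd G ∷ []) h h′ →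
                        ∀ (s s′ : Fin 2) → Linked S (combine h s) (combine h′ s′)
    half-edges-linked {h} ε s s′ = sides-linked h s s′
    half-edges-linked {h} (st ◅ p) s s′ =
      let s₁ , s₂ , link = half-edge-step-linked st in
      sides-linked h s s₁ ◅◅ link ◅◅ half-edges-linked p s₂ s′

    all-linked : ∀ {h₀} → (∀ h → Path (rotF G ∷ otherEnd G ∷ []) h h₀) → ∀ x y → Linked S x y
    all-linked to-h₀ x y with combined-view {nEdges ℕ.* 2} {2} x | combined-view {nEdges ℕ.* 2} {2} y
    ... | combined h s | combined h′ s′ =
      half-edges-linked (to-h₀ h) s 0F ◅◅ linked-sym S (half-edges-linked (to-h₀ h′) s′ 0F)

  edgeInvOf-cong : ∀ {S S′} → (∀ e → S e ≡ S′ e) → ∀ x → edgeInvOf S x ≡ edgeInvOf S′ x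
  edgeInvOf-cong {S} {S′} S≗S′ x with flagView x
  ... | flag-view e p = trans (edgeInvOf-flag S e p)
                              (trans (cong (λ m → flag e (arcEnds m p)) (S≗S′ e)) (sym (edgeInvOf-flag S′ e p)))

  allPresent⇒partialPetrial : ∀ {S} → AllPresent S → ∃[ A ] ∀ e → S e ≡ just (twisted e xor lookup A e)
  allPresent⇒partialPetrial all-present = tabulate (λ e → twisted e xor twist e) , λ e →
    trans (proj₂ (all-present e)) (cong just (sym (begin
      twisted e xor lookup (tabulate (λ e → twisted e xor twist e)) e ≡⟨ cong (twisted e xor_) (lookup∘tabulate _ e) ⟩
      twisted e xor (twisted e xor twist e)                            ≡⟨ sym (xor-assoc (twisted e) _ _) ⟩
      (twisted e xor twisted e) xor twist e                            ≡⟨ cong (_xor twist e) (xor-same (twisted e)) ⟩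
      twist e                                                          ∎)))
    where
    twist : Fin nEdges → Bool
    twist e = proj₁ (all-present e)
    open ≡-Reasoning

module _ (G : RibbonGraph) (A : Vec Bool (RibbonGraph.nEdges G)) where
  open RibbonGraph G

  cornerInv-partialPetrial : ∀ x → cornerInv (partialPetrial G A) x ≡ cornerInv G x
  cornerInv-partialPetrial x with combined-view {nEdges ℕ.* 2} {2} x
  ... | combined h 0F = trans (cornerInv-combine (partialPetrial G A) h 0F) (sym (cornerInv-combine G h 0F))
  ... | combined h 1F = trans (cornerInv-combine (partialPetrial G A) h 1F) (sym (cornerInv-combine G h 1F))

  edgeInv-partialPetrial : ∀ x → edgeInv (partialPetrial G A) x ≡ edgeInvOf G (λ e → just (twisted e xor lookup A e)) x
  edgeInv-partialPetrial x with flagView G x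
  ... | flag-view e (b , s) = trans (edgeInv-flag (partialPetrial G A) e b s)
                                    (sym (edgeInvOf-flag G (λ e → just (twisted e xor lookup A e)) e (b , s)))

single-boundary-partialPetrial : ∀ G {h₀ : HalfEdge G} → (∀ h → Path (rotF G ∷ otherEnd G ∷ []) h h₀) →
  ∃[ A ] ∀ x y → Path (cornerInv (partialPetrial G A) ∷ edgeInv (partialPetrial G A) ∷ []) x y
single-boundary-partialPetrial G to-h₀ =
  let S , sides , all-present = insert-all G (allFin _) (λ _ → nothing) (sidesLinked-empty G) (λ e _ → ∈-allFin e)
      A , S≗ = allPresent⇒partialPetrial G all-present
  in A , λ x y → path-cong (sym ∘ cornerInv-partialPetrial G A
                            ∷ (λ x → trans (edgeInvOf-cong G S≗ x) (sym (edgeInv-partialPetrial G A x))) ∷ [])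
                           (all-linked G S sides all-present to-h₀ x y)

faces-pos : ∀ H → Connected H → 0 < f H
faces-pos record { nEdges = zero } c≡1 = subst (0 <_) (sym c≡1) (s≤s z≤n)
faces-pos H@record { nEdges = suc _ ; nIsolated = i } _ =
  ≤-trans (orbits-pos (cornerInv H ∷ edgeInv H ∷ [])) (m≤n+m (orbits (cornerInv H ∷ edgeInv H ∷ [])) i)

one-face-partialPetrial : ∀ G → Connected G → ∃[ A ] f (partialPetrial G A) ≡ 1
one-face-partialPetrial record { nEdges = zero } c≡1 = [] , c≡1
one-face-partialPetrial G@record { nEdges = suc _ ; nIsolated = i } c≡1 =
  let A , flags-linked = single-boundary-partialPetrial G (orbits≡1⇒path-to-zero _ half-edge-orbits≡1)
  in A , trans (cong (i ℕ.+_) (trans (orbits≡1 _ flags-linked) (sym half-edge-orbits≡1))) c≡1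
  where
  half-edge-orbits≡1 : orbits (rotF G ∷ otherEnd G ∷ []) ≡ 1
  half-edge-orbits≡1 = ≤-antisym (subst (orbits (rotF G ∷ otherEnd G ∷ []) ≤_) c≡1 (m≤n+m _ i))
                                 (orbits-pos (rotF G ∷ otherEnd G ∷ []))

eulerGenus-connected : ∀ H → c H ≡ 1 → ∀ k → f H ≡ suc k → eulerGenus H ≡ + e H - + v H + + 1 - + k
eulerGenus-connected H c≡1 k f≡1+k =
  trans (cong₂ (λ c′ f′ → + (2 ℕ.* c′) - + v H + + e H - + f′) c≡1 f≡1+k)
        (solve 3 (λ v e k → con (+ 2) :- v :+ e :- (con (+ 1) :+ k) := e :- v :+ con (+ 1) :- k) refl (+ v H) (+ e H) (+ k))
  where open +-*-Solver

highestDegree-max : ∀ {X : Set} (xs : List X) (g : X → ℤ) {d x} →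
  (∀ y → g y ℤ.≤ d) → x ∈ xs → g x ≡ d →
  HighestDegree (λ k → length (filter (λ y → g y ℤ.≟ k) xs)) d
highestDegree-max xs g {d} bound x∈xs gx≡d = nonzero , vanishes
  where
  nonzero : length (filter (λ y → g y ℤ.≟ d) xs) ≢ 0
  nonzero with filter (λ y → g y ℤ.≟ d) xs | ∈-filter⁺ (λ y → g y ℤ.≟ d) x∈xs gx≡d
  ... | _ ∷ _ | _ = λ ()

  vanishes : ∀ k → d ℤ.< k → length (filter (λ y → g y ℤ.≟ k) xs) ≡ 0
  vanishes k d<k = cong length (filter-none (λ y → g y ℤ.≟ k)
    (All.universal (λ y gy≡k → ℤ.<-irrefl gy≡k (ℤ.≤-<-trans (bound y) d<k)) xs))

∈-allSubsets : ∀ {m} (A : Vec Bool m) → A ∈ allSubsets m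
∈-allSubsets []                = here refl
∈-allSubsets {suc m} (true ∷ A)  = ∈-++⁺ˡ (∈-map⁺ (true ∷_) (∈-allSubsets A))
∈-allSubsets {suc m} (false ∷ A) = ∈-++⁺ʳ (map (true ∷_) (allSubsets m)) (∈-map⁺ (false ∷_) (∈-allSubsets A))

proposition3p2 : (G : RibbonGraph) → Connected G →
    HighestDegree (partialPetrialPoly G) (+ e G - + v G + + 1)
proposition3p2 G c≡1 =
  let A , one-face = one-face-partialPetrial G c≡1
  in highestDegree-max (allSubsets _) (eulerGenus ∘ partialPetrial G) genus≤ (∈-allSubsets A)
       (trans (eulerGenus-connected (partialPetrial G A) c≡1 0 one-face) (ℤ.+-identityʳ _))
  where
  genus≤ : ∀ A → eulerGenus (partialPetrial G A) ℤ.≤ + e G - + v G + + 1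
  genus≤ A =
    let k , 1+k≡f = m≤n⇒∃[o]m+o≡n (faces-pos (partialPetrial G A) c≡1)
    in subst (ℤ._≤ _) (sym (eulerGenus-connected (partialPetrial G A) c≡1 k (sym 1+k≡f))) (ℤ.i-j≤i _ (+ k))
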